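{- Let $G$ be a group, $H$ a subgroup of $G$ and $A$ a normal subgroup of $G$ such that $H \leq A \leq G$. If $A$ is a perfect code of $(G,H)$, then for any $x \in G$ with $x^2 \in A$ there exists $b \in A$ such that $(xb)^2 \in H$.
   Context: All groups are finite. For a group $G$, a subgroup $H\leq G$ and a subset $U\subseteq G$ which is a union of double cosets of $H$ with $H\cap U=\emptyset$ and $U^{ -1}=U$, the coset graph $\mathrm{Cos}(G,H,U)$ has as vertex set the set of left cosets of $H$ in $G$, with $g_1H$ and $g_2H$ adjacent iff $g_1^{ -1}g_2\in U$. A perfect code in a graph is an independent set $C$ of vertices such that every vertex outside $C$ is adjacent to exactly one vertex of $C$. For $H\leq A\leq G$, $A$ is called a perfect code of the pair $(G,H)$ if there is a coset graph $\mathrm{Cos}(G,H,U)$ in which the set $\{aH: a\in A\}$ of left cosets of $H$ contained in $A$ is a perfect code. -}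

module Defs where

open import Data.Nat using (ℕ)
open import Data.Fin using (Fin)
open import Data.Fin.Subset using (Subset; _∈_; _∉_)
open import Data.Product using (Σ; ∃; _×_)
open import Relation.Binary.PropositionalEquality using (_≡_)
open import Relation.Nullary using (¬_)

-- A finite group of order n, realised on the carrier Fin n
-- (every finite group is isomorphic to one of this form).
record FinGroup (n : ℕ) : Set where
  infixl 7 _∙_
  field
    _∙_   : Fin n → Fin n → Fin n
    e     : Fin n
    _⁻¹   : Fin n → Fin n
    assoc : ∀ x y z → (x ∙ y) ∙ z ≡ x ∙ (y ∙ z)
    idˡ   : ∀ x → e ∙ x ≡ x
    idʳ   : ∀ x → x ∙ e ≡ x
    invˡ  : ∀ x → (x ⁻¹) ∙ x ≡ e
    invʳ  : ∀ x → x ∙ (x ⁻¹) ≡ e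

module _ {n : ℕ} (G : FinGroup n) where
  open FinGroup G

  record IsSubgroup (S : Subset n) : Set where
    field
      e∈   : e ∈ S
      ∙∈   : ∀ {x y} → x ∈ S → y ∈ S → x ∙ y ∈ S
      ⁻¹∈  : ∀ {x} → x ∈ S → x ⁻¹ ∈ S

  IsNormal : Subset n → Set
  IsNormal A = ∀ g a → a ∈ A → (g ∙ a) ∙ (g ⁻¹) ∈ A

  _⊆ₛ_ : Subset n → Subset n → Set
  S ⊆ₛ T = ∀ {x} → x ∈ S → x ∈ T

  -- U is an admissible connection set for Cos(G,H,U):
  -- a union of double cosets HuH, disjoint from H, and closed under inverses.
  record IsCosetConnectionSet (H U : Subset n) : Set where
    field
      doubleCoset : ∀ h₁ u h₂ → h₁ ∈ H → u ∈ U → h₂ ∈ H → (h₁ ∙ u) ∙ h₂ ∈ U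
      disjoint    : ∀ x → x ∈ H → x ∉ U
      symmetric   : ∀ x → x ∈ U → x ⁻¹ ∈ U

  -- Vertices of Cos(G,H,U) are left cosets gH; we work with representatives.
  -- g₁H and g₂H are adjacent iff g₁⁻¹ g₂ ∈ U (well defined since U = HUH).
  Adj : Subset n → Fin n → Fin n → Set
  Adj U g₁ g₂ = (g₁ ⁻¹) ∙ g₂ ∈ U

  SameCoset : Subset n → Fin n → Fin n → Set
  SameCoset H g₁ g₂ = (g₁ ⁻¹) ∙ g₂ ∈ H

  -- The set of cosets {aH : a ∈ A} (H ≤ A, so gH lies in it iff g ∈ A)
  -- is a perfect code in Cos(G,H,U).
  record IsPerfectCodeCos (H U A : Subset n) : Set where
    field
      independent : ∀ a₁ a₂ → a₁ ∈ A → a₂ ∈ A → ¬ Adj U a₁ a₂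
      covered     : ∀ g → g ∉ A → ∃ λ a → a ∈ A × Adj U g a
      unique      : ∀ g → g ∉ A → ∀ a₁ a₂ → a₁ ∈ A → a₂ ∈ A →
                    Adj U g a₁ → Adj U g a₂ → SameCoset H a₁ a₂

  IsPerfectCodeOfPair : Subset n → Subset n → Set
  IsPerfectCodeOfPair H A =
    Σ (Subset n) λ U → IsCosetConnectionSet H U × IsPerfectCodeCos H U A

-- If x ∈ A, b = x⁻¹ works. Otherwise x⁻¹ ∉ A has a unique neighbour aH in the
-- code. Because U is inverse-closed, the "mirror" c = x⁻¹ a⁻¹ x⁻¹ is also a
-- neighbour of x⁻¹, and c ∈ A because A is normal and x² ∈ A. Uniqueness of the
-- neighbour gives c⁻¹ a ∈ H, and c⁻¹ a = (xa)².
module Submission where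

open import Defs
open import Level using (0ℓ)
open import Algebra.Bundles using (Group)
import Algebra.Properties.Group as GroupProperties
open import Data.Nat using (ℕ)
open import Data.Fin using (Fin)
open import Data.Fin.Subset using (Subset; _∈_; _∉_)
open import Data.Fin.Subset.Properties using (_∈?_)
open import Data.Product using (∃; _×_; _,_)
open import Relation.Nullary using (yes; no)
open import Relation.Binary.PropositionalEquality

finGroup→Group : ∀ {n} → FinGroup n → Group 0ℓ 0ℓ
finGroup→Group {n} G = record
  { Carrier = Fin n
  ; _≈_     = _≡_
  ; _∙_     = _∙_
  ; ε       = e
  ; _⁻¹     = _⁻¹
  ; isGroup = record
    { isMonoid = record
      { isSemigroup = record
        { isMagma = record { isEquivalence = isEquivalence ; ∙-cong = cong₂ _∙_ }
        ; assoc   = assoc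
        }
      ; identity = idˡ , idʳ
      }
    ; inverse = invˡ , invʳ
    ; ⁻¹-cong = cong _⁻¹
    }
  }
  where open FinGroup G

module _ {n : ℕ} (G : FinGroup n) where
  open FinGroup G
  open GroupProperties (finGroup→Group G)
    using (⁻¹-involutive; ⁻¹-anti-homo-∙; \\-leftDividesʳ)
  open ≡-Reasoning

  ⁻¹-∉ : ∀ {S x} → IsSubgroup G S → x ∉ S → x ⁻¹ ∉ S
  ⁻¹-∉ {S} {x} sS x∉S x⁻¹∈S =
    x∉S (subst (_∈ S) (⁻¹-involutive x) (IsSubgroup.⁻¹∈ sS x⁻¹∈S))

  mirror : Fin n → Fin n → Fin n
  mirror g a = g ∙ a ⁻¹ ∙ g

  mirror-adjacent : ∀ {U g a} → (∀ x → x ∈ U → x ⁻¹ ∈ U) →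
                    Adj G U g a → Adj G U g (mirror g a)
  mirror-adjacent {U} {g} {a} symmetric adj =
    subst (_∈ U) (begin
      (g ⁻¹ ∙ a) ⁻¹         ≡⟨ ⁻¹-anti-homo-∙ (g ⁻¹) a ⟩
      a ⁻¹ ∙ g ⁻¹ ⁻¹        ≡⟨ cong (a ⁻¹ ∙_) (⁻¹-involutive g) ⟩
      a ⁻¹ ∙ g              ≡⟨ \\-leftDividesʳ g (a ⁻¹ ∙ g) ⟨
      g ⁻¹ ∙ (g ∙ (a ⁻¹ ∙ g)) ≡⟨ cong (g ⁻¹ ∙_) (assoc g (a ⁻¹) g) ⟨
      g ⁻¹ ∙ mirror g a     ∎)
      (symmetric _ adj)

  mirror-∈ : ∀ {A g a} → IsSubgroup G A → IsNormal G A →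
             g ∙ g ∈ A → a ∈ A → mirror g a ∈ A
  mirror-∈ {A} {g} {a} sA nA gg∈A a∈A =
    subst (_∈ A) (begin
      g ∙ a ⁻¹ ∙ g ⁻¹ ∙ (g ∙ g)   ≡⟨ assoc (g ∙ a ⁻¹) (g ⁻¹) (g ∙ g) ⟩
      g ∙ a ⁻¹ ∙ (g ⁻¹ ∙ (g ∙ g)) ≡⟨ cong (g ∙ a ⁻¹ ∙_) (\\-leftDividesʳ g g) ⟩
      mirror g a                  ∎)
      (IsSubgroup.∙∈ sA (nA g (a ⁻¹) (IsSubgroup.⁻¹∈ sA a∈A)) gg∈A)

  mirror⁻¹∙≡square : ∀ g a → mirror g a ⁻¹ ∙ a ≡ (g ⁻¹ ∙ a) ∙ (g ⁻¹ ∙ a)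
  mirror⁻¹∙≡square g a = begin
    (g ∙ a ⁻¹ ∙ g) ⁻¹ ∙ a         ≡⟨ cong (_∙ a) (⁻¹-anti-homo-∙ (g ∙ a ⁻¹) g) ⟩
    g ⁻¹ ∙ (g ∙ a ⁻¹) ⁻¹ ∙ a      ≡⟨ cong (λ t → g ⁻¹ ∙ t ∙ a) (⁻¹-anti-homo-∙ g (a ⁻¹)) ⟩
    g ⁻¹ ∙ (a ⁻¹ ⁻¹ ∙ g ⁻¹) ∙ a   ≡⟨ cong (λ t → g ⁻¹ ∙ (t ∙ g ⁻¹) ∙ a) (⁻¹-involutive a) ⟩
    g ⁻¹ ∙ (a ∙ g ⁻¹) ∙ a         ≡⟨ cong (_∙ a) (assoc (g ⁻¹) a (g ⁻¹)) ⟨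
    g ⁻¹ ∙ a ∙ g ⁻¹ ∙ a           ≡⟨ assoc (g ⁻¹ ∙ a) (g ⁻¹) a ⟩
    (g ⁻¹ ∙ a) ∙ (g ⁻¹ ∙ a)       ∎

  perfectCode-neighbour-square∈ :
    ∀ {H U A g a} → IsCosetConnectionSet G H U → IsPerfectCodeCos G H U A →
    IsSubgroup G A → IsNormal G A →
    g ∉ A → g ∙ g ∈ A → a ∈ A → Adj G U g a →
    (g ⁻¹ ∙ a) ∙ (g ⁻¹ ∙ a) ∈ H
  perfectCode-neighbour-square∈ {H} {g = g} {a} cs pc sA nA g∉A gg∈A a∈A adj =
    subst (_∈ H) (mirror⁻¹∙≡square g a)
      (IsPerfectCodeCos.unique pc g g∉A (mirror g a) a
        (mirror-∈ sA nA gg∈A a∈A) a∈A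
        (mirror-adjacent (IsCosetConnectionSet.symmetric cs) adj) adj)

  squareCorrection-∉ :
    ∀ {H U A x} → IsCosetConnectionSet G H U → IsPerfectCodeCos G H U A →
    IsSubgroup G A → IsNormal G A → x ∉ A → x ∙ x ∈ A →
    ∃ λ b → b ∈ A × (x ∙ b) ∙ (x ∙ b) ∈ H
  squareCorrection-∉ {H} {A = A} {x} cs pc sA nA x∉A xx∈A
    with IsPerfectCodeCos.covered pc (x ⁻¹) (⁻¹-∉ sA x∉A)
  ... | a , a∈A , adj = a , a∈A ,
        subst (λ y → y ∙ a ∙ (y ∙ a) ∈ H) (⁻¹-involutive x)
          (perfectCode-neighbour-square∈ cs pc sA nA (⁻¹-∉ sA x∉A) x⁻¹x⁻¹∈A a∈A adj)
    where
    x⁻¹x⁻¹∈A : x ⁻¹ ∙ x ⁻¹ ∈ A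
    x⁻¹x⁻¹∈A = subst (_∈ A) (⁻¹-anti-homo-∙ x x) (IsSubgroup.⁻¹∈ sA xx∈A)

  squareCorrection-∈ : ∀ {H x} → IsSubgroup G H → (x ∙ x ⁻¹) ∙ (x ∙ x ⁻¹) ∈ H
  squareCorrection-∈ {H} {x} sH =
    subst (_∈ H) (sym (trans (cong₂ _∙_ (invʳ x) (invʳ x)) (idˡ e))) (IsSubgroup.e∈ sH)

corollary3p9 : ∀ {n} (G : FinGroup n) (H A : Subset n) →
    IsSubgroup G H → IsSubgroup G A → IsNormal G A → _⊆ₛ_ G H A →
    IsPerfectCodeOfPair G H A →
    ∀ x → FinGroup._∙_ G x x ∈ A →
    ∃ λ b → b ∈ A × FinGroup._∙_ G (FinGroup._∙_ G x b) (FinGroup._∙_ G x b) ∈ H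
corollary3p9 G H A sH sA nA _ (U , cs , pc) x xx∈A with x ∈? A
... | yes x∈A = FinGroup._⁻¹ G x , IsSubgroup.⁻¹∈ sA x∈A , squareCorrection-∈ G sH
... | no x∉A  = squareCorrection-∉ G cs pc sA nA x∉A xx∈A
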